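{- Let $n\ge 3$ with $3\mid n$ and set $\Delta=2n/3$. Then there exists a strong tricentral $2$-tree $G$ on $n$ vertices whose core induces $K_3$, whose tail vertices all have degree in $\{2,3\}$, and whose degree sequence is $\left(\frac{2n}{3},\frac{2n}{3},\frac{2n}{3},2^{(n-3)}\right)$.
   Context: A $2$-tree is a graph obtained from the triangle $K_3$ by repeatedly adding a new vertex adjacent to both endpoints of an existing edge. For $r\in\{1,2,3\}$ and an integer $\Delta\ge 2$, a $2$-tree on $n$ vertices is $r$-central with maximum degree $\Delta$ if $\Delta$ is its maximum degree and exactly $r$ vertices have degree $\Delta$; these $r$ vertices form the core and the other $n-r$ vertices form the tail. It is strong if the core induces $K_r$. "Tricentral" means $3$-central. The notation $2^{(k)}$ means $k$ entries equal to $2$. -}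

module Defs where

open import Data.Nat using (ℕ; zero; suc; _+_; _≟_; _≤_)
open import Data.Bool using (Bool; true; false; if_then_else_; not; _∨_)
open import Data.Fin using (Fin; zero; suc)
import Data.Fin as F
open import Data.List using (List; map; filter; length; allFin)
open import Data.Nat.ListAction using (sum)
open import Data.Sum using (_⊎_)
open import Data.Product using (_×_; ∃)
open import Relation.Nullary using (¬_)
open import Relation.Nullary.Decidable using (isYes)
open import Relation.Binary.PropositionalEquality using (_≡_; _≢_)

-- A (simple, undirected) graph on vertex set Fin n, given by a Boolean adjacency function.
Graph : ℕ → Set
Graph n = Fin n → Fin n → Bool

triangle : Graph 3
triangle i j = not (isYes (i F.≟ j))

-- Add a new vertex (labelled zero; old vertex i becomes suc i) adjacent exactly to u and v.
addVertex : ∀ {n} → Graph n → Fin n → Fin n → Graph (suc n)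
addVertex E u v zero    zero    = false
addVertex E u v zero    (suc j) = isYes (j F.≟ u) ∨ isYes (j F.≟ v)
addVertex E u v (suc i) zero    = isYes (i F.≟ u) ∨ isYes (i F.≟ v)
addVertex E u v (suc i) (suc j) = E i j

data TwoTree : (n : ℕ) → Graph n → Set where
  base   : TwoTree 3 triangle
  extend : ∀ {n} {E : Graph n} → TwoTree n E → (u v : Fin n) → E u v ≡ true →
           TwoTree (suc n) (addVertex E u v)

deg : ∀ {n} → Graph n → Fin n → ℕ
deg {n} E i = sum (map (λ j → if E i j then 1 else 0) (allFin n))

IsMaxDegree : ∀ {n} → Graph n → ℕ → Set
IsMaxDegree E Δ = (∀ i → deg E i ≤ Δ) × ∃ (λ i → deg E i ≡ Δ)

countDeg : ∀ {n} → Graph n → ℕ → ℕ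
countDeg {n} E Δ = length (filter (λ i → deg E i ≟ Δ) (allFin n))

-- r-central with maximum degree Δ: Δ is the max degree and exactly r vertices have degree Δ.
-- The core is the set of vertices of degree Δ; the tail is the rest.
RCentral : ∀ {n} → ℕ → ℕ → Graph n → Set
RCentral r Δ E = IsMaxDegree E Δ × countDeg E Δ ≡ r

CoreComplete : ∀ {n} → ℕ → Graph n → Set
CoreComplete Δ E = ∀ i j → deg E i ≡ Δ → deg E j ≡ Δ → i ≢ j → E i j ≡ true

StrongRCentral : ∀ {n} → ℕ → ℕ → Graph n → Set
StrongRCentral r Δ E = RCentral r Δ E × CoreComplete Δ E

-- The degree sequence of E as a list (vertex order); equality of degree
-- sequences is taken up to permutation (i.e. as multisets).
degSeq : ∀ {n} → Graph n → List ℕ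
degSeq {n} E = map (deg E) (allFin n)

{-# OPTIONS --safe #-}
module Submission where

-- Start from a triangle abc and, k times, attach one new vertex to each of the three sides ab, bc
-- and ca. Every round raises the degrees of a, b and c by two and leaves all other degrees alone,
-- while the new vertices have degree 2. After k rounds there are n = 3k + 3 vertices, the three
-- corners have degree 2k + 2 = 2n/3, and they still form a triangle.

open import Defs
open import Data.Nat using (ℕ; zero; suc; _+_; _*_; _∸_; _≤_) renaming (_≟_ to _≟ℕ_)
open import Data.Nat.Properties using (+-assoc; ≤-reflexive; ≤-trans; m≤m+n)
open import Data.Nat.DivMod using (_/_; m*n/n≡m)
open import Data.Nat.Divisibility using (_∣_; divides)
open import Data.Nat.ListAction using (sum)
open import Data.Nat.Tactic.RingSolver using (solve-∀)
open import Data.Bool using (Bool; true; false; if_then_else_; _∨_)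
open import Data.Bool.Properties using (∨-identityʳ)
open import Data.Fin using (Fin; zero; suc; _↑ˡ_)
open import Data.Fin.Properties using (_≟_; suc-injective)
open import Data.List using (List; []; _∷_; _++_; map; filter; length; tabulate; allFin; replicate)
open import Data.List.Properties using (map-tabulate; tabulate-cong; length-map; filter-accept; filter-none)
open import Data.List.Relation.Unary.All.Properties using (replicate⁺)
open import Data.List.Relation.Binary.Permutation.Propositional using (_↭_; prep; ↭-refl; ↭-reflexive; ↭-trans)
open import Data.List.Relation.Binary.Permutation.Propositional.Properties using (shifts; ↭-length; filter-↭)
open import Data.Product using (Σ; _×_; _,_)
open import Data.Sum using (_⊎_; inj₁)
open import Data.Empty using (⊥-elim)
open import Function using (_∘_)
open import Level using (Level)
open import Relation.Nullary using (yes; no; does; contradiction)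
open import Relation.Nullary.Decidable using (isYes; isYes≗does)
open import Relation.Unary using (Pred; Decidable)
open import Relation.Binary.PropositionalEquality using (_≡_; _≢_; refl; sym; trans; cong; cong₂; module ≡-Reasoning)

private
  variable
    n : ℕ

indicator : Bool → ℕ
indicator b = if b then 1 else 0

-- Stated with does rather than isYes: does (suc i ≟ suc j) reduces to does (i ≟ j), isYes does not.
oneOf₂ : Fin n → Fin n → Fin n → Bool
oneOf₂ i u v = does (i ≟ u) ∨ does (i ≟ v)

oneOf₃ : Fin n → Fin n → Fin n → Fin n → Bool
oneOf₃ i a b c = does (i ≟ a) ∨ does (i ≟ b) ∨ does (i ≟ c)

isYes-oneOf₂ : (i u v : Fin n) → (isYes (i ≟ u) ∨ isYes (i ≟ v)) ≡ oneOf₂ i u v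
isYes-oneOf₂ i u v = cong₂ _∨_ (isYes≗does (i ≟ u)) (isYes≗does (i ≟ v))

sum-tabulate-zero : ∀ n → sum (tabulate {n = n} (λ _ → 0)) ≡ 0
sum-tabulate-zero zero    = refl
sum-tabulate-zero (suc n) = sum-tabulate-zero n

sum-indicator-≟ : (u : Fin n) → sum (tabulate (λ j → indicator (does (j ≟ u)))) ≡ 1
sum-indicator-≟ {suc n} zero = cong suc (sum-tabulate-zero n)
sum-indicator-≟ (suc u)      = sum-indicator-≟ u

sum-indicator-oneOf₂ : (u v : Fin n) → u ≢ v → sum (tabulate (λ j → indicator (oneOf₂ j u v))) ≡ 2
sum-indicator-oneOf₂ zero    zero    u≢v = ⊥-elim (u≢v refl)
sum-indicator-oneOf₂ zero    (suc v) u≢v = cong suc (sum-indicator-≟ v)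
sum-indicator-oneOf₂ (suc u) zero    u≢v = cong suc (trans
  (cong sum (tabulate-cong (λ j → cong indicator (∨-identityʳ (does (j ≟ u))))))
  (sum-indicator-≟ u))
sum-indicator-oneOf₂ (suc u) (suc v) u≢v = sum-indicator-oneOf₂ u v (u≢v ∘ cong suc)

filter-map : {A B : Set} {p : Level} {P : Pred B p} (P? : Decidable P) (f : A → B) (xs : List A) →
  filter P? (map f xs) ≡ map f (filter (P? ∘ f) xs)
filter-map P? f []       = refl
filter-map P? f (x ∷ xs) with does (P? (f x))
... | true  = cong (f x ∷_) (filter-map P? f xs)
... | false = filter-map P? f xs

length-filter-≟-replicate : ∀ m r {d e : ℕ} → d ≢ e →
  length (filter (_≟ℕ d) (replicate m d ++ replicate r e)) ≡ m
length-filter-≟-replicate zero    r {d} d≢e = cong length (filter-none (_≟ℕ d) (replicate⁺ r (d≢e ∘ sym)))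
length-filter-≟-replicate (suc m) r {d} d≢e =
  trans (cong length (filter-accept (_≟ℕ d) refl)) (cong suc (length-filter-≟-replicate m r d≢e))

deg-tabulate : (E : Graph n) (i : Fin n) → deg E i ≡ sum (tabulate (λ j → indicator (E i j)))
deg-tabulate E i = cong sum (map-tabulate (λ j → j) (indicator ∘ E i))

countDeg-degSeq : (E : Graph n) (Δ : ℕ) → countDeg E Δ ≡ length (filter (_≟ℕ Δ) (degSeq E))
countDeg-degSeq {n} E Δ = trans (sym (length-map (deg E) (filter (λ i → deg E i ≟ℕ Δ) (allFin n))))
  (cong length (sym (filter-map (_≟ℕ Δ) (deg E) (allFin n))))

deg-addVertex-suc : (E : Graph n) (u v i : Fin n) →
  deg (addVertex E u v) (suc i) ≡ indicator (oneOf₂ i u v) + deg E i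
deg-addVertex-suc E u v i = trans (deg-tabulate (addVertex E u v) (suc i))
  (cong₂ _+_ (cong indicator (isYes-oneOf₂ i u v)) (sym (deg-tabulate E i)))

deg-addVertex-zero : (E : Graph n) (u v : Fin n) → u ≢ v → deg (addVertex E u v) zero ≡ 2
deg-addVertex-zero E u v u≢v = trans (deg-tabulate (addVertex E u v) zero) (trans
  (cong sum (tabulate-cong (λ j → cong indicator (isYes-oneOf₂ j u v))))
  (sum-indicator-oneOf₂ u v u≢v))

triangle-adjacent : {i j : Fin 3} → i ≢ j → triangle i j ≡ true
triangle-adjacent {i} {j} i≢j with i ≟ j
... | yes i≡j = ⊥-elim (i≢j i≡j)
... | no _    = refl

-- The ear on ca is vertex 0, the ear on bc vertex 1, the ear on ab vertex 2; old vertex i is now i + 3.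
addEars : Graph n → Fin n → Fin n → Fin n → Graph (3 + n)
addEars E a b c = addVertex (addVertex (addVertex E a b) (suc b) (suc c)) (suc (suc c)) (suc (suc a))

addEars-twoTree : {E : Graph n} {a b c : Fin n} → TwoTree n E →
  E a b ≡ true → E b c ≡ true → E c a ≡ true → TwoTree (3 + n) (addEars E a b c)
addEars-twoTree {a = a} {b} {c} t ab bc ca =
  extend (extend (extend t a b ab) (suc b) (suc c) bc) (suc (suc c)) (suc (suc a)) ca

incident-sides : {a b c : Fin n} → a ≢ b → b ≢ c → c ≢ a → (i : Fin n) →
  indicator (oneOf₂ i c a) + (indicator (oneOf₂ i b c) + indicator (oneOf₂ i a b))
    ≡ (if oneOf₃ i a b c then 2 else 0)
incident-sides {a = a} {b} {c} a≢b b≢c c≢a i with i ≟ a | i ≟ b | i ≟ c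
... | yes refl | yes refl | _        = ⊥-elim (a≢b refl)
... | yes refl | no _     | yes refl = ⊥-elim (c≢a refl)
... | no _     | yes refl | yes refl = ⊥-elim (b≢c refl)
... | yes _    | no _     | no _     = refl
... | no _     | yes _    | no _     = refl
... | no _     | no _     | yes _    = refl
... | no _     | no _     | no _     = refl

module AddEars (E : Graph n) (a b c : Fin n) (a≢b : a ≢ b) (b≢c : b ≢ c) (c≢a : c ≢ a) where

  private
    E₁ : Graph (1 + n)
    E₁ = addVertex E a b
    E₂ : Graph (2 + n)
    E₂ = addVertex E₁ (suc b) (suc c)

  deg-addEars-new : (j : Fin 3) → deg (addEars E a b c) (j ↑ˡ n) ≡ 2
  deg-addEars-new zero = deg-addVertex-zero E₂ (suc (suc c)) (suc (suc a)) (c≢a ∘ suc-injective ∘ suc-injective)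
  deg-addEars-new (suc zero) = trans (deg-addVertex-suc E₂ (suc (suc c)) (suc (suc a)) zero)
    (deg-addVertex-zero E₁ (suc b) (suc c) (b≢c ∘ suc-injective))
  deg-addEars-new (suc (suc zero)) = trans (deg-addVertex-suc E₂ (suc (suc c)) (suc (suc a)) (suc zero))
    (trans (deg-addVertex-suc E₁ (suc b) (suc c) zero) (deg-addVertex-zero E a b a≢b))

  deg-addEars-old : (i : Fin n) →
    deg (addEars E a b c) (suc (suc (suc i))) ≡ (if oneOf₃ i a b c then 2 else 0) + deg E i
  deg-addEars-old i = begin
    deg (addEars E a b c) (suc (suc (suc i)))
      ≡⟨ deg-addVertex-suc E₂ (suc (suc c)) (suc (suc a)) (suc (suc i)) ⟩
    ca + deg E₂ (suc (suc i))
      ≡⟨ cong (ca +_) (deg-addVertex-suc E₁ (suc b) (suc c) (suc i)) ⟩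
    ca + (bc + deg E₁ (suc i))
      ≡⟨ cong (λ d → ca + (bc + d)) (deg-addVertex-suc E a b i) ⟩
    ca + (bc + (ab + deg E i))
      ≡⟨ trans (cong (ca +_) (sym (+-assoc bc ab (deg E i)))) (sym (+-assoc ca (bc + ab) (deg E i))) ⟩
    (ca + (bc + ab)) + deg E i
      ≡⟨ cong (_+ deg E i) (incident-sides a≢b b≢c c≢a i) ⟩
    (if oneOf₃ i a b c then 2 else 0) + deg E i ∎
    where
    open ≡-Reasoning
    ab bc ca : ℕ
    ab = indicator (oneOf₂ i a b)
    bc = indicator (oneOf₂ i b c)
    ca = indicator (oneOf₂ i c a)

order : ℕ → ℕ
order k = 3 + k * 3

coreDegree : ℕ → ℕ
coreDegree k = 2 + k * 2

corner : ∀ k → Fin 3 → Fin (order k)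
corner zero    j = j
corner (suc k) j = suc (suc (suc (corner k j)))

earedTriangle : ∀ k → Graph (order k)
earedTriangle zero    = triangle
earedTriangle (suc k) = addEars (earedTriangle k) (corner k zero) (corner k (suc zero)) (corner k (suc (suc zero)))

isCorner : ∀ k → Fin (order k) → Bool
isCorner k v = oneOf₃ v (corner k zero) (corner k (suc zero)) (corner k (suc (suc zero)))

corner-injective : ∀ k {x y} → corner k x ≡ corner k y → x ≡ y
corner-injective zero    eq = eq
corner-injective (suc k) eq = corner-injective k (suc-injective (suc-injective (suc-injective eq)))

corner-≢ : ∀ k {x y} → x ≢ y → corner k x ≢ corner k y
corner-≢ k x≢y = x≢y ∘ corner-injective k

module EarRound (k : ℕ) = AddEars (earedTriangle k) (corner k zero) (corner k (suc zero)) (corner k (suc (suc zero)))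
  (corner-≢ k (λ ())) (corner-≢ k (λ ())) (corner-≢ k (λ ()))

isCorner-corner : ∀ k j → isCorner k (corner k j) ≡ true
isCorner-corner zero    zero             = refl
isCorner-corner zero    (suc zero)       = refl
isCorner-corner zero    (suc (suc zero)) = refl
isCorner-corner (suc k) j                = isCorner-corner k j

deg-earedTriangle : ∀ k v → deg (earedTriangle k) v ≡ (if isCorner k v then coreDegree k else 2)
deg-earedTriangle zero    zero                = refl
deg-earedTriangle zero    (suc zero)          = refl
deg-earedTriangle zero    (suc (suc zero))    = refl
deg-earedTriangle (suc k) zero                = EarRound.deg-addEars-new k zero
deg-earedTriangle (suc k) (suc zero)          = EarRound.deg-addEars-new k (suc zero)
deg-earedTriangle (suc k) (suc (suc zero))    = EarRound.deg-addEars-new k (suc (suc zero))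
deg-earedTriangle (suc k) (suc (suc (suc i))) = trans (EarRound.deg-addEars-old k i)
  (trans (cong ((if isCorner k i then 2 else 0) +_) (deg-earedTriangle k i)) (grow (isCorner k i)))
  where
  grow : ∀ b → (if b then 2 else 0) + (if b then coreDegree k else 2) ≡ (if b then coreDegree (suc k) else 2)
  grow true  = refl
  grow false = refl

isCorner-coreDegree : ∀ k v → deg (earedTriangle k) v ≡ coreDegree k → isCorner k v ≡ true
isCorner-coreDegree zero zero             _ = refl
isCorner-coreDegree zero (suc zero)       _ = refl
isCorner-coreDegree zero (suc (suc zero)) _ = refl
isCorner-coreDegree (suc k) v deg≡ with isCorner (suc k) v | deg-earedTriangle (suc k) v
... | true  | _     = refl
... | false | deg≡2 = contradiction (trans (sym deg≡2) deg≡) λ ()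

deg-≤-coreDegree : ∀ k v → deg (earedTriangle k) v ≤ coreDegree k
deg-≤-coreDegree k v with isCorner k v | deg-earedTriangle k v
... | true  | deg≡ = ≤-reflexive deg≡
... | false | deg≡ = ≤-trans (≤-reflexive deg≡) (m≤m+n 2 (k * 2))

deg-tail : ∀ k v → deg (earedTriangle k) v ≢ coreDegree k → deg (earedTriangle k) v ≡ 2
deg-tail k v deg≢ with isCorner k v | deg-earedTriangle k v
... | true  | deg≡ = ⊥-elim (deg≢ deg≡)
... | false | deg≡ = deg≡

core-adjacent : ∀ k {u v} → isCorner k u ≡ true → isCorner k v ≡ true → u ≢ v → earedTriangle k u v ≡ true
core-adjacent zero _ _ u≢v = triangle-adjacent u≢v
core-adjacent (suc k) {zero}             ()
core-adjacent (suc k) {suc zero}         ()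
core-adjacent (suc k) {suc (suc zero)}   ()
core-adjacent (suc k) {suc (suc (suc _))} {zero}           _ ()
core-adjacent (suc k) {suc (suc (suc _))} {suc zero}       _ ()
core-adjacent (suc k) {suc (suc (suc _))} {suc (suc zero)} _ ()
core-adjacent (suc k) {suc (suc (suc _))} {suc (suc (suc _))} cu cv u≢v =
  core-adjacent k cu cv (u≢v ∘ cong (λ w → suc (suc (suc w))))

corner-adjacent : ∀ k {x y} → x ≢ y → earedTriangle k (corner k x) (corner k y) ≡ true
corner-adjacent k {x} {y} x≢y = core-adjacent k (isCorner-corner k x) (isCorner-corner k y) (corner-≢ k x≢y)

earedTriangle-twoTree : ∀ k → TwoTree (order k) (earedTriangle k)
earedTriangle-twoTree zero    = base
earedTriangle-twoTree (suc k) =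
  addEars-twoTree (earedTriangle-twoTree k) (corner-adjacent k (λ ())) (corner-adjacent k (λ ())) (corner-adjacent k (λ ()))

tabulate-isCorner-↭ : ∀ k (x y : ℕ) → tabulate (λ v → if isCorner k v then x else y) ↭ x ∷ x ∷ x ∷ replicate (k * 3) y
tabulate-isCorner-↭ zero    x y = ↭-refl
tabulate-isCorner-↭ (suc k) x y =
  ↭-trans (prep y (prep y (prep y (tabulate-isCorner-↭ k x y)))) (shifts (y ∷ y ∷ y ∷ []) (x ∷ x ∷ x ∷ []))

earedTriangle-degSeq : ∀ k → degSeq (earedTriangle k) ↭ coreDegree k ∷ coreDegree k ∷ coreDegree k ∷ replicate (k * 3) 2
earedTriangle-degSeq k = ↭-trans
  (↭-reflexive (trans (map-tabulate (λ v → v) (deg (earedTriangle k))) (tabulate-cong (deg-earedTriangle k))))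
  (tabulate-isCorner-↭ k (coreDegree k) 2)

countDeg-earedTriangle : ∀ k → countDeg (earedTriangle k) (coreDegree k) ≡ 3
countDeg-earedTriangle k = trans (countDeg-degSeq (earedTriangle k) (coreDegree k))
  (trans (↭-length (filter-↭ (_≟ℕ coreDegree k) (earedTriangle-degSeq k))) (core-count k))
  where
  core-count : ∀ k → length (filter (_≟ℕ coreDegree k) (replicate 3 (coreDegree k) ++ replicate (k * 3) 2)) ≡ 3
  core-count zero    = refl
  core-count (suc k) = length-filter-≟-replicate 3 (suc k * 3) {coreDegree (suc k)} {2} λ ()

earedTriangle-strongTricentral : ∀ k → StrongRCentral 3 (coreDegree k) (earedTriangle k)
earedTriangle-strongTricentral k =
  ((deg-≤-coreDegree k , corner k zero , deg-corner) , countDeg-earedTriangle k) ,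
  λ u v deg-u deg-v → core-adjacent k (isCorner-coreDegree k u deg-u) (isCorner-coreDegree k v deg-v)
  where
  deg-corner : deg (earedTriangle k) (corner k zero) ≡ coreDegree k
  deg-corner = trans (deg-earedTriangle k (corner k zero))
    (cong (λ b → if b then coreDegree k else 2) (isCorner-corner k zero))

twoThirds-order : ∀ k → 2 * order k / 3 ≡ coreDegree k
twoThirds-order k = trans (cong (_/ 3) (double-order k)) (m*n/n≡m (coreDegree k) 3)
  where
  double-order : ∀ k → 2 * (3 + k * 3) ≡ (2 + k * 2) * 3
  double-order = solve-∀

theorem5p4 : (n : ℕ) → 3 ≤ n → 3 ∣ n →
    Σ (Graph n) (λ G →
      TwoTree n G
      × StrongRCentral 3 ((2 * n) / 3) G
      × (∀ i → deg G i ≢ (2 * n) / 3 → (deg G i ≡ 2 ⊎ deg G i ≡ 3))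
      × (degSeq G ↭ ((2 * n) / 3) ∷ ((2 * n) / 3) ∷ ((2 * n) / 3) ∷ replicate (n ∸ 3) 2))
theorem5p4 .0 () (divides zero refl)
theorem5p4 _ _ (divides (suc k) refl) rewrite twoThirds-order k =
  earedTriangle k ,
  earedTriangle-twoTree k ,
  earedTriangle-strongTricentral k ,
  (λ v deg≢ → inj₁ (deg-tail k v deg≢)) ,
  earedTriangle-degSeq k
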